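{- Let $N = q^k n^2$ be an odd perfect number given in Eulerian form. Define $H = \gcd(n^2,\sigma(n^2))$, $I = \gcd(n,\sigma(n^2))$ and $J = H/I$. Then each of the following conditions is equivalent to $J = 1$: (1) $n$ divides $\sigma(q^k)/2$; (2) $\sigma(n^2)$ divides $q^k n$.
   Context: $\sigma(x)$ denotes the sum of the positive divisors of $x$. A positive integer $N$ is perfect if $\sigma(N)=2N$. An odd perfect number $N$ is said to be given in Eulerian form $N = q^k n^2$ if $q$ is a prime (the special prime), $k$ and $n$ are positive integers, $q \equiv k \equiv 1 \pmod 4$, and $\gcd(q,n)=1$. -}

module Defs where

open import Data.Nat using (ℕ; zero; suc; _+_; _*_; _^_; NonZero; ≢-nonZero)
open import Data.Nat.Divisibility using (_∣_; _∣?_)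
open import Data.Nat.GCD using (gcd; gcd[m,n]≢0)
open import Data.Nat.DivMod using (_/_)
open import Data.Nat.Primality using (Prime)
open import Data.List using (List; filter; upTo; map)
open import Data.Nat.ListAction using (sum)
open import Data.Sum using (inj₁)
open import Data.Product using (_×_)
open import Relation.Binary.PropositionalEquality using (_≡_; _≢_)

divisors : ℕ → List ℕ
divisors x = filter (λ d → d ∣? x) (map suc (upTo x))

σ : ℕ → ℕ
σ x = sum (divisors x)

Perfect : ℕ → Set
Perfect N = σ N ≡ 2 * N

-- N = q^k n^2 is an odd perfect number in Eulerian form
-- (k ≥ 1 follows from k ≡ 1 mod 4; n ≥ 1 is required separately as NonZero n)
EulerianOPN : ℕ → ℕ → ℕ → ℕ → Set
EulerianOPN N q k n =
  (N ≡ q ^ k * n ^ 2) × Perfect N × (N Data.Nat.% 2 ≡ 1) × Prime q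
  × (q Data.Nat.% 4 ≡ 1) × (k Data.Nat.% 4 ≡ 1) × (gcd q n ≡ 1)

H : ℕ → ℕ
H n = gcd (n ^ 2) (σ (n ^ 2))

I : ℕ → ℕ
I n = gcd n (σ (n ^ 2))

I-nonZero : ∀ n → .{{NonZero n}} → NonZero (I n)
I-nonZero (suc n) = ≢-nonZero (gcd[m,n]≢0 (suc n) (σ (suc n ^ 2)) (inj₁ (λ ())))

J : (n : ℕ) → .{{NonZero n}} → ℕ
J n = (H n / I n) {{I-nonZero n}}

-- σ is multiplicative, so σ(q^k) σ(n²) = 2 q^k n².  Since k and q are odd,
-- σ(q^k) = 1 + q + ⋯ + q^k is even, say 2a, and it is coprime to q; hence
-- q^k ∣ σ(n²), i.e. σ(n²) = b q^k with a b = n².  As q^k is coprime to n,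
-- H = gcd(n², b) = b and I = gcd(n, b), so J = 1 ⇔ b ∣ n.  From a b = n² we get
-- b ∣ n ⇔ n ∣ a = σ(q^k)/2, and σ(n²) ∣ q^k n ⇔ b ∣ n is immediate.
module Submission where

open import Defs
open import Data.Nat
open import Data.Nat.Properties
open import Data.Nat.Divisibility
open import Data.Nat.DivMod using (/-congˡ; /-congʳ; n/n≡1; m*n/n≡m; m/n*n≡m; m≡m%n+[m/n]*n)
open import Data.Nat.GCD using (gcd; gcd[m,n]∣m; gcd[m,n]∣n; gcd-greatest; gcd[m,n]≢0)
open import Data.Nat.Coprimality as Coprimality using (Coprime; coprime-divisor; coprime-/gcd; gcd≡1⇒coprime)
open import Data.Nat.Primality using (Prime; prime⇒irreducible; prime⇒nonZero; ¬prime[1])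
open import Data.Nat.ListAction using (sum)
open import Data.Nat.ListAction.Properties using (sum-↭; sum-++)
open import Data.Nat.Tactic.RingSolver using (solve-∀)
open import Algebra.Properties.CommutativeSemigroup *-commutativeSemigroup using (xy∙z≈xz∙y; x∙yz≈yx∙z)
open import Data.List using (List; []; _∷_; map; filter; upTo; cartesianProduct)
open import Data.List.Properties using (map-++; map-∘)
open import Data.List.Membership.Propositional using (_∈_)
open import Data.List.Membership.Propositional.Properties
  using (∈-filter⁺; ∈-filter⁻; ∈-map⁺; ∈-map⁻; ∈-upTo⁺; ∈-cartesianProduct⁺; ∈-cartesianProduct⁻)
open import Data.List.Membership.Propositional.Properties.WithK using (unique∧set⇒bag)
open import Data.List.Relation.Unary.Any using (here; there)
open import Data.List.Relation.Unary.All as All using ([]; _∷_)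
import Data.List.Relation.Unary.All.Properties as All
open import Data.List.Relation.Unary.AllPairs using ([]; _∷_)
open import Data.List.Relation.Unary.Unique.Propositional using (Unique)
import Data.List.Relation.Unary.Unique.Propositional.Properties as Unique
open import Data.List.Relation.Binary.BagAndSetEquality using (∼bag⇒↭)
open import Data.Product using (_×_; _,_; ∃-syntax; ∃₂; uncurry)
open import Data.Sum using (inj₁; inj₂)
open import Data.Empty using (⊥-elim)
open import Function using (_∘_)
open import Function.Bundles using (_⇔_; mk⇔; Equivalence)
open import Function.Construct.Composition using (_⇔-∘_)
open import Function.Construct.Symmetry using (⇔-sym)
open import Level using (Level)
open import Relation.Nullary using (¬_; yes; no)
open import Relation.Binary.PropositionalEquality hiding (J)

private
  variable
    ℓ₁ ℓ₂ : Level
    b c d m n o p q x : ℕ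

∈-divisors : .{{NonZero x}} → d ∈ divisors x ⇔ (d ∣ x × NonZero d)
∈-divisors {x} {d} = mk⇔ to from
  where
  to : d ∈ divisors x → d ∣ x × NonZero d
  to d∈ with d∈suc , d∣x ← ∈-filter⁻ (_∣? x) {xs = map suc (upTo x)} d∈
         with _ , _ , refl ← ∈-map⁻ suc d∈suc = d∣x , _
  from : ∀ {d} → d ∣ x × NonZero d → d ∈ divisors x
  from {suc _} (d∣x , _) = ∈-filter⁺ (_∣? x) (∈-map⁺ suc (∈-upTo⁺ (∣⇒≤ d∣x))) d∣x

divisors-unique : ∀ x → Unique (divisors x)
divisors-unique x = Unique.filter⁺ (_∣? x) (Unique.map⁺ suc-injective (Unique.upTo⁺ x))

σ≡sum : .{{NonZero x}} → {xs : List ℕ} → Unique xs →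
        (∀ {d} → d ∈ xs ⇔ (d ∣ x × NonZero d)) → σ x ≡ sum xs
σ≡sum {x} xs! ∈xs =
  sum-↭ (∼bag⇒↭ (unique∧set⇒bag (divisors-unique x) xs! (⇔-sym ∈xs ⇔-∘ ∈-divisors)))

map⁺-injectiveOn : {A : Set ℓ₁} {B : Set ℓ₂} {f : A → B} {xs : List A} →
                   (∀ {y z} → y ∈ xs → z ∈ xs → f y ≡ f z → y ≡ z) →
                   Unique xs → Unique (map f xs)
map⁺-injectiveOn inj [] = []
map⁺-injectiveOn inj (y∉ys ∷ ys!) =
  All.map⁺ (All.tabulate (λ z∈ → All.lookup y∉ys z∈ ∘ inj (here refl) (there z∈)))
  ∷ map⁺-injectiveOn (λ y∈ z∈ → inj (there y∈) (there z∈)) ys!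

sum-map-* : ∀ c xs → sum (map (c *_) xs) ≡ c * sum xs
sum-map-* c [] = sym (*-zeroʳ c)
sum-map-* c (x ∷ xs) = trans (cong (c * x +_) (sum-map-* c xs)) (sym (*-distribˡ-+ c x (sum xs)))

sum-products : ∀ xs ys → sum (map (uncurry _*_) (cartesianProduct xs ys)) ≡ sum xs * sum ys
sum-products [] ys = refl
sum-products (x ∷ xs) ys = begin
  sum (map (uncurry _*_) (map (x ,_) ys ++ cartesianProduct xs ys))
    ≡⟨ cong sum (map-++ (uncurry _*_) (map (x ,_) ys) (cartesianProduct xs ys)) ⟩
  sum (map (uncurry _*_) (map (x ,_) ys) ++ map (uncurry _*_) (cartesianProduct xs ys))
    ≡⟨ sum-++ (map (uncurry _*_) (map (x ,_) ys)) _ ⟩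
  sum (map (uncurry _*_) (map (x ,_) ys)) + sum (map (uncurry _*_) (cartesianProduct xs ys))
    ≡⟨ cong₂ _+_ (trans (cong sum (sym (map-∘ ys))) (sum-map-* x ys)) (sum-products xs ys) ⟩
  x * sum ys + sum xs * sum ys
    ≡⟨ sym (*-distribʳ-+ (sum ys) x (sum xs)) ⟩
  (x + sum xs) * sum ys ∎
  where open ≡-Reasoning
        open Data.List using (_++_)

coprime-∣ʳ : Coprime m n → o ∣ n → Coprime m o
coprime-∣ʳ cop o∣n (i∣m , i∣o) = cop (i∣m , ∣-trans i∣o o∣n)

coprime-∣ˡ : Coprime m n → o ∣ m → Coprime o n
coprime-∣ˡ m⊥n o∣m = Coprimality.sym (coprime-∣ʳ (Coprimality.sym m⊥n) o∣m)

coprime-*ʳ : Coprime m n → Coprime m o → Coprime m (n * o)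
coprime-*ʳ m⊥n m⊥o (i∣m , i∣no) = m⊥o (i∣m , coprime-divisor (coprime-∣ˡ m⊥n i∣m) i∣no)

coprime-^ʳ : Coprime m n → ∀ k → Coprime m (n ^ k)
coprime-^ʳ m⊥n zero (_ , i∣1) = ∣1⇒≡1 i∣1
coprime-^ʳ m⊥n (suc k) = coprime-*ʳ m⊥n (coprime-^ʳ m⊥n k)

coprime-^ˡ : Coprime m n → ∀ k → Coprime (m ^ k) n
coprime-^ˡ m⊥n k = Coprimality.sym (coprime-^ʳ (Coprimality.sym m⊥n) k)

∣⇒nonZero : .{{NonZero n}} → m ∣ n → NonZero m
∣⇒nonZero {m = zero} {{n≢0}} 0∣n = ⊥-elim (≢-nonZero⁻¹ _ {{n≢0}} (0∣⇒≡0 0∣n))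
∣⇒nonZero {m = suc _} _ = _

∣m*n⇒∃∣m,∣n : .{{NonZero d}} → d ∣ m * n → ∃₂ λ a b → a ∣ m × b ∣ n × d ≡ a * b
∣m*n⇒∃∣m,∣n {d} {m} {n} d∣mn =
  g , d / g , gcd[m,n]∣n d m , d/g∣n , sym (trans (*-comm g (d / g)) (m/n*n≡m (gcd[m,n]∣m d m)))
  where
  g = gcd d m
  instance
    g≢0 : NonZero g
    g≢0 = ≢-nonZero (gcd[m,n]≢0 d m (inj₁ (≢-nonZero⁻¹ d)))
  d/g*g∣m/g*g*n : d / g * g ∣ m / g * n * g
  d/g*g∣m/g*g*n = subst₂ _∣_ (sym (m/n*n≡m (gcd[m,n]∣m d m)))
    (trans (cong (_* n) (sym (m/n*n≡m (gcd[m,n]∣n d m)))) (xy∙z≈xz∙y (m / g) g n))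
    d∣mn
  d/g∣n : d / g ∣ n
  d/g∣n = coprime-divisor (coprime-/gcd d m) (*-cancelʳ-∣ g d/g*g∣m/g*g*n)

coprime-factors-unique : ∀ {a b a′ b′} → Coprime m n → a ∣ m → b ∣ n → a′ ∣ m → b′ ∣ n →
                         a * b ≡ a′ * b′ → a ≡ a′
coprime-factors-unique {m = m} {n = n} {a} {b} {a′} {b′} m⊥n a∣m b∣n a′∣m b′∣n ab≡a′b′ =
  ∣-antisym (cancel-coprime a∣m b′∣n (subst (a ∣_) ab≡a′b′ (m∣m*n b)))
            (cancel-coprime a′∣m b∣n (subst (a′ ∣_) (sym ab≡a′b′) (m∣m*n b′)))
  where
  cancel-coprime : ∀ {u v w} → u ∣ m → v ∣ n → u ∣ w * v → u ∣ w
  cancel-coprime {u} {v} {w} u∣m v∣n u∣wv = coprime-divisor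
    (coprime-∣ʳ (coprime-∣ˡ m⊥n u∣m) v∣n)
    (subst (u ∣_) (*-comm w v) u∣wv)

σ-multiplicative : .{{_ : NonZero m}} .{{_ : NonZero n}} → Coprime m n → σ (m * n) ≡ σ m * σ n
σ-multiplicative {m} {n} m⊥n =
  trans (σ≡sum {{m*n≢0 m n}} products! ∈products) (sum-products (divisors m) (divisors n))
  where
  pairs = cartesianProduct (divisors m) (divisors n)
  products = map (uncurry _*_) pairs

  factors-injective : ∀ {u v} → u ∈ pairs → v ∈ pairs → uncurry _*_ u ≡ uncurry _*_ v → u ≡ v
  factors-injective {a , b} {a′ , b′} ab∈ a′b′∈ ab≡a′b′
    with a∈ , b∈ ← ∈-cartesianProduct⁻ (divisors m) (divisors n) ab∈
       | a′∈ , b′∈ ← ∈-cartesianProduct⁻ (divisors m) (divisors n) a′b′∈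
    with a∣m , a≢0 ← Equivalence.to ∈-divisors a∈ | b∣n , _ ← Equivalence.to ∈-divisors b∈
       | a′∣m , _ ← Equivalence.to ∈-divisors a′∈ | b′∣n , _ ← Equivalence.to ∈-divisors b′∈
    with refl ← coprime-factors-unique m⊥n a∣m b∣n a′∣m b′∣n ab≡a′b′
    = cong (a ,_) (*-cancelˡ-≡ b b′ a {{a≢0}} ab≡a′b′)

  products! : Unique products
  products! = map⁺-injectiveOn factors-injective
    (Unique.cartesianProduct⁺ (divisors-unique m) (divisors-unique n))

  ∈products : ∀ {d} → d ∈ products ⇔ (d ∣ m * n × NonZero d)
  ∈products {d} = mk⇔ to from
    where
    to : d ∈ products → d ∣ m * n × NonZero d
    to d∈ with (a , b) , ab∈ , refl ← ∈-map⁻ (uncurry _*_) d∈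
           with a∈ , b∈ ← ∈-cartesianProduct⁻ (divisors m) (divisors n) ab∈
           with a∣m , a≢0 ← Equivalence.to ∈-divisors a∈ | b∣n , b≢0 ← Equivalence.to ∈-divisors b∈
           = *-pres-∣ a∣m b∣n , m*n≢0 a b {{a≢0}} {{b≢0}}
    from : d ∣ m * n × NonZero d → d ∈ products
    from (d∣mn , d≢0) with a , b , a∣m , b∣n , refl ← ∣m*n⇒∃∣m,∣n {m = m} {n = n} {{d≢0}} d∣mn =
      ∈-map⁺ (uncurry _*_) (∈-cartesianProduct⁺
        (Equivalence.from ∈-divisors (a∣m , m*n≢0⇒m≢0 a {{d≢0}}))
        (Equivalence.from ∈-divisors (b∣n , m*n≢0⇒n≢0 a {{d≢0}})))

powers : ℕ → ℕ → List ℕ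
powers q zero = 1 ∷ []
powers q (suc k) = 1 ∷ map (q *_) (powers q k)

1∈powers : ∀ q k → 1 ∈ powers q k
1∈powers q zero = here refl
1∈powers q (suc k) = here refl

∈-powers⁻ : .{{NonZero q}} → ∀ k → x ∈ powers q k → x ∣ q ^ k × NonZero x
∈-powers⁻ zero (here refl) = 1∣ 1 , _
∈-powers⁻ (suc k) (here refl) = 1∣ _ , _
∈-powers⁻ {q} {{q≢0}} (suc k) (there x∈) with y , y∈ , refl ← ∈-map⁻ (q *_) x∈
  with y∣q^k , y≢0 ← ∈-powers⁻ k y∈ = *-monoʳ-∣ q y∣q^k , m*n≢0 q y {{q≢0}} {{y≢0}}

¬∣⇒coprime : Prime p → ¬ p ∣ n → Coprime n p
¬∣⇒coprime p-prime p∤n (i∣n , i∣p) with prime⇒irreducible p-prime i∣p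
... | inj₁ i≡1 = i≡1
... | inj₂ refl = ⊥-elim (p∤n i∣n)

prime∤1 : Prime p → ¬ p ∣ 1
prime∤1 p-prime p∣1 = ¬prime[1] (subst Prime (∣1⇒≡1 p∣1) p-prime)

∈-powers⁺ : Prime p → ∀ k → x ∣ p ^ k → x ∈ powers p k
∈-powers⁺ {p} {x} p-prime k x∣p^k with p ∣? x
... | no p∤x = subst (_∈ powers p k) (sym x≡1) (1∈powers p k)
  where
  x≡1 : x ≡ 1
  x≡1 = ∣1⇒≡1 (coprime-divisor (coprime-^ʳ (¬∣⇒coprime p-prime p∤x) k)
                               (subst (x ∣_) (sym (*-identityʳ (p ^ k))) x∣p^k))
∈-powers⁺ p-prime zero x∣1 | yes p∣x = ⊥-elim (prime∤1 p-prime (∣-trans p∣x x∣1))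
∈-powers⁺ {p} p-prime (suc k′) x∣p^k | yes (divides y refl) =
  there (subst (_∈ map (p *_) (powers p k′)) (*-comm p y) (∈-map⁺ (p *_) (∈-powers⁺ p-prime k′ y∣p^k′)))
  where
  y∣p^k′ : y ∣ p ^ k′
  y∣p^k′ = *-cancelʳ-∣ p {{prime⇒nonZero p-prime}} (subst (y * p ∣_) (*-comm p (p ^ k′)) x∣p^k)

powers-unique : Prime p → ∀ k → Unique (powers p k)
powers-unique p-prime zero = [] ∷ []
powers-unique {p} p-prime (suc k) =
  All.map⁺ (All.tabulate (λ {y} _ 1≡py → prime∤1 p-prime (divides y (trans 1≡py (*-comm p y)))))
  ∷ Unique.map⁺ (*-cancelˡ-≡ _ _ p {{prime⇒nonZero p-prime}}) (powers-unique p-prime k)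

σ[p^k]≡sum-powers : Prime p → ∀ k → σ (p ^ k) ≡ sum (powers p k)
σ[p^k]≡sum-powers {p} p-prime k = σ≡sum {{m^n≢0 p k}} (powers-unique p-prime k)
  (mk⇔ (∈-powers⁻ k) (λ (d∣p^k , _) → ∈-powers⁺ p-prime k d∣p^k))
  where instance _ = prime⇒nonZero p-prime

sum-powers-suc : ∀ q k → sum (powers q (suc k)) ≡ 1 + q * sum (powers q k)
sum-powers-suc q k = cong (1 +_) (sum-map-* q (powers q k))

sum-powers-coprime : ∀ q k → Coprime (sum (powers q k)) q
sum-powers-coprime q zero (i∣1 , _) = ∣1⇒≡1 i∣1
sum-powers-coprime q (suc k) {i} (i∣sum , i∣q) =
  ∣1⇒≡1 (∣m+n∣m⇒∣n (subst (i ∣_) (trans (sum-powers-suc q k) (+-comm 1 _)) i∣sum)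
                    (∣m⇒∣m*n _ i∣q))

∣sum-powers-odd : d ∣ 1 + q → ∀ j → d ∣ sum (powers q (suc (j * 2)))
∣sum-powers-odd {d} {q} d∣1+q zero =
  subst (d ∣_) (sym (trans (sum-powers-suc q 0) (cong (1 +_) (*-identityʳ q)))) d∣1+q
∣sum-powers-odd {d} {q} d∣1+q (suc j) =
  subst (d ∣_) (sym sum≡) (∣m∣n⇒∣m+n d∣1+q (∣n⇒∣m*n q (∣n⇒∣m*n q (∣sum-powers-odd d∣1+q j))))
  where
  s = sum (powers q (suc (j * 2)))
  sum≡ : sum (powers q (suc (suc j * 2))) ≡ (1 + q) + q * (q * s)
  sum≡ = begin
    sum (powers q (suc (suc j * 2)))           ≡⟨ sum-powers-suc q (suc (suc (j * 2))) ⟩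
    1 + q * sum (powers q (suc (suc (j * 2)))) ≡⟨ cong (λ t → 1 + q * t) (sum-powers-suc q (suc (j * 2))) ⟩
    1 + q * (1 + q * s)                        ≡⟨ expand q s ⟩
    (1 + q) + q * (q * s)                      ∎
    where
    open ≡-Reasoning
    expand : ∀ q s → 1 + q * (1 + q * s) ≡ (1 + q) + q * (q * s)
    expand = solve-∀

σ[p^k]-coprime : Prime p → ∀ k → Coprime (σ (p ^ k)) (p ^ k)
σ[p^k]-coprime {p} p-prime k =
  coprime-^ʳ (subst (λ s → Coprime s p) (sym (σ[p^k]≡sum-powers p-prime k)) (sum-powers-coprime p k)) k

∣σ[p^odd] : Prime p → d ∣ 1 + p → ∀ j → d ∣ σ (p ^ suc (j * 2))
∣σ[p^odd] {p} {d} p-prime d∣1+p j =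
  subst (d ∣_) (sym (σ[p^k]≡sum-powers p-prime (suc (j * 2)))) (∣sum-powers-odd d∣1+p j)

%4≡1⇒n≡1+[n/4*2]*2 : ∀ n → n % 4 ≡ 1 → n ≡ suc (n / 4 * 2 * 2)
%4≡1⇒n≡1+[n/4*2]*2 n n%4≡1 = trans (m≡m%n+[m/n]*n n 4) (cong₂ _+_ n%4≡1 (sym (*-assoc (n / 4) 2 2)))

gcd-∣ʳ : n ∣ m → gcd m n ≡ n
gcd-∣ʳ {n = n} {m = m} n∣m = ∣-antisym (gcd[m,n]∣n m n) (gcd-greatest n∣m ∣-refl)

gcd-*-coprimeʳ : Coprime m c → gcd m (n * c) ≡ gcd m n
gcd-*-coprimeʳ {m} {c} {n} m⊥c =
  ∣-antisym g∣gcd[m,n] (gcd-greatest (gcd[m,n]∣m m n) (∣m⇒∣m*n c (gcd[m,n]∣n m n)))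
  where
  g = gcd m (n * c)
  g∣gcd[m,n] : g ∣ gcd m n
  g∣gcd[m,n] = gcd-greatest (gcd[m,n]∣m m (n * c))
    (coprime-divisor (coprime-∣ˡ m⊥c (gcd[m,n]∣m m (n * c)))
      (subst (g ∣_) (*-comm n c) (gcd[m,n]∣n m (n * c))))

m/gcd[n,m]≡1⇔m∣n : ∀ m n .{{_ : NonZero m}} .{{_ : NonZero (gcd n m)}} → (m / gcd n m ≡ 1) ⇔ m ∣ n
m/gcd[n,m]≡1⇔m∣n m n = mk⇔
  (λ m/g≡1 → subst (_∣ n) (gcd≡m m/g≡1) (gcd[m,n]∣m n m))
  (λ m∣n → trans (/-congʳ (gcd-∣ʳ m∣n)) (n/n≡1 m))
  where
  gcd≡m : m / gcd n m ≡ 1 → gcd n m ≡ m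
  gcd≡m m/g≡1 = trans (sym (*-identityˡ (gcd n m)))
    (trans (cong (_* gcd n m) (sym m/g≡1)) (m/n*n≡m (gcd[m,n]∣n n m)))

coprime-cancel : ∀ {a} .{{_ : NonZero q}} → Coprime a q → a * c ≡ q * m → ∃[ b ] c ≡ b * q × a * b ≡ m
coprime-cancel {q} {c} {m} {a} a⊥q ac≡qm =
  c/q , c≡c/q*q , *-cancelʳ-≡ (a * c/q) m q
    (trans (*-assoc a c/q q) (trans (cong (a *_) (sym c≡c/q*q)) (trans ac≡qm (*-comm q m))))
  where
  open _∣_ (coprime-divisor (Coprimality.sym a⊥q) (subst (q ∣_) (sym ac≡qm) (m∣m*n m)))
    renaming (quotient to c/q; equality to c≡c/q*q)

∣⇔∣-of-product-square : ∀ {a} .{{_ : NonZero n}} .{{_ : NonZero b}} → a * b ≡ n * n → n ∣ a ⇔ b ∣ n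
∣⇔∣-of-product-square {n} {b} {a} ab≡nn = mk⇔
  (λ (divides c a≡cn) → divides c (sym (*-cancelʳ-≡ (c * b) n n
    (trans (xy∙z≈xz∙y c b n) (trans (cong (_* b) (sym a≡cn)) ab≡nn)))))
  (λ (divides c n≡cb) → divides c (*-cancelʳ-≡ a (c * n) b
    (trans ab≡nn (trans (cong (_* n) n≡cb) (xy∙z≈xz∙y c b n)))))

*-cancelʳ-∣-⇔ : ∀ o .{{_ : NonZero o}} → m * o ∣ o * n ⇔ m ∣ n
*-cancelʳ-∣-⇔ {m} {n} o = mk⇔
  (λ mo∣on → *-cancelʳ-∣ o (subst (m * o ∣_) (*-comm o n) mo∣on))
  (λ m∣n → subst (m * o ∣_) (*-comm n o) (*-monoˡ-∣ o m∣n))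

J≡1⇔∣ : .{{_ : NonZero n}} → Coprime n c → σ (n ^ 2) ≡ b * c → b ∣ n ^ 2 → J n ≡ 1 ⇔ b ∣ n
J≡1⇔∣ {n} {c} {b} n⊥c σ[n²]≡bc b∣n² =
  subst (λ x → x ≡ 1 ⇔ b ∣ n) (sym J≡b/gcd[n,b]) (m/gcd[n,m]≡1⇔m∣n b n)
  where
  instance
    I≢0 = I-nonZero n
    b≢0 : NonZero b
    b≢0 = ∣⇒nonZero {{m^n≢0 n 2}} b∣n²
    gcd[n,b]≢0 : NonZero (gcd n b)
    gcd[n,b]≢0 = ≢-nonZero (gcd[m,n]≢0 n b (inj₁ (≢-nonZero⁻¹ n)))
  H≡b : H n ≡ b
  H≡b = trans (cong (gcd (n ^ 2)) σ[n²]≡bc) (trans (gcd-*-coprimeʳ (coprime-^ˡ n⊥c 2)) (gcd-∣ʳ b∣n²))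
  I≡gcd[n,b] : I n ≡ gcd n b
  I≡gcd[n,b] = trans (cong (gcd n) σ[n²]≡bc) (gcd-*-coprimeʳ n⊥c)
  J≡b/gcd[n,b] : J n ≡ b / gcd n b
  J≡b/gcd[n,b] = trans (/-congˡ {o = I n} H≡b) (/-congʳ I≡gcd[n,b])

J≡1-criteria : ∀ {a b c} .{{_ : NonZero n}} .{{_ : NonZero c}} → Coprime n c →
               σ (n ^ 2) ≡ b * c → a * b ≡ n ^ 2 →
               (J n ≡ 1 ⇔ n ∣ a) × (J n ≡ 1 ⇔ σ (n ^ 2) ∣ c * n)
J≡1-criteria {n} {a} {b} {c} n⊥c σ[n²]≡bc ab≡n² =
  ⇔-sym n∣a⇔b∣n ⇔-∘ J≡1⇔b∣n , ⇔-sym σ[n²]∣cn⇔b∣n ⇔-∘ J≡1⇔b∣n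
  where
  b∣n² : b ∣ n ^ 2
  b∣n² = subst (b ∣_) ab≡n² (n∣m*n a)
  instance
    b≢0 : NonZero b
    b≢0 = ∣⇒nonZero {{m^n≢0 n 2}} b∣n²
  J≡1⇔b∣n : J n ≡ 1 ⇔ b ∣ n
  J≡1⇔b∣n = J≡1⇔∣ n⊥c σ[n²]≡bc b∣n²
  n∣a⇔b∣n : n ∣ a ⇔ b ∣ n
  n∣a⇔b∣n = ∣⇔∣-of-product-square (trans ab≡n² (cong (n *_) (*-identityʳ n)))
  σ[n²]∣cn⇔b∣n : σ (n ^ 2) ∣ c * n ⇔ b ∣ n
  σ[n²]∣cn⇔b∣n = subst (λ x → x ∣ c * n ⇔ b ∣ n) (sym σ[n²]≡bc) (*-cancelʳ-∣-⇔ c)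

eulerian-split : ∀ N q k n → EulerianOPN N q k n → .{{NonZero n}} →
                 ∃[ a ] σ (q ^ k) ≡ a * 2 × ∃[ b ] σ (n ^ 2) ≡ b * q ^ k × a * b ≡ n ^ 2
eulerian-split N q k n (N≡q^kn² , perfect , _ , q-prime , q%4≡1 , k%4≡1 , gcd[q,n]≡1) =
  a , σ[q^k]≡a*2 , coprime-cancel a⊥q^k a*σ[n²]≡q^k*n²
  where
  instance
    q≢0 = prime⇒nonZero q-prime
    q^k≢0 = m^n≢0 q k
    n²≢0 = m^n≢0 n 2
  2∣1+q : 2 ∣ 1 + q
  2∣1+q = divides (suc (q / 4 * 2)) (cong suc (%4≡1⇒n≡1+[n/4*2]*2 q q%4≡1))
  2∣σ[q^k] : 2 ∣ σ (q ^ k)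
  2∣σ[q^k] = subst (λ k → 2 ∣ σ (q ^ k)) (sym (%4≡1⇒n≡1+[n/4*2]*2 k k%4≡1))
                   (∣σ[p^odd] q-prime 2∣1+q (k / 4 * 2))
  open _∣_ 2∣σ[q^k] renaming (quotient to a; equality to σ[q^k]≡a*2)
  σ[q^k]*σ[n²]≡2*q^k*n² : σ (q ^ k) * σ (n ^ 2) ≡ 2 * (q ^ k * n ^ 2)
  σ[q^k]*σ[n²]≡2*q^k*n² = begin
    σ (q ^ k) * σ (n ^ 2) ≡⟨ sym (σ-multiplicative (coprime-^ˡ (coprime-^ʳ (gcd≡1⇒coprime gcd[q,n]≡1) 2) k)) ⟩
    σ (q ^ k * n ^ 2)     ≡⟨ cong σ (sym N≡q^kn²) ⟩
    σ N                   ≡⟨ perfect ⟩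
    2 * N                 ≡⟨ cong (2 *_) N≡q^kn² ⟩
    2 * (q ^ k * n ^ 2)   ∎
    where open ≡-Reasoning
  a*σ[n²]≡q^k*n² : a * σ (n ^ 2) ≡ q ^ k * n ^ 2
  a*σ[n²]≡q^k*n² = *-cancelˡ-≡ _ _ 2
    (trans (x∙yz≈yx∙z 2 a (σ (n ^ 2)))
           (trans (cong (_* σ (n ^ 2)) (sym σ[q^k]≡a*2)) σ[q^k]*σ[n²]≡2*q^k*n²))
  a⊥q^k : Coprime a (q ^ k)
  a⊥q^k = coprime-∣ˡ (σ[p^k]-coprime q-prime k) (divides 2 (trans σ[q^k]≡a*2 (*-comm a 2)))

theorem1 : (N q k n : ℕ) → (E : EulerianOPN N q k n) → .{{_ : NonZero n}} →
    ((J n ≡ 1) ⇔ (n ∣ σ (q ^ k) / 2)) × ((J n ≡ 1) ⇔ (σ (n ^ 2) ∣ q ^ k * n))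
theorem1 N q k n E@(_ , _ , _ , q-prime , _ , _ , gcd[q,n]≡1) =
  let a , σ[q^k]≡a*2 , _ , σ[n²]≡bq^k , ab≡n² = eulerian-split N q k n E
      σ[q^k]/2≡a = trans (/-congˡ σ[q^k]≡a*2) (m*n/n≡m a 2)
  in subst (λ x → (J n ≡ 1 ⇔ n ∣ x) × (J n ≡ 1 ⇔ σ (n ^ 2) ∣ q ^ k * n)) (sym σ[q^k]/2≡a)
       (J≡1-criteria (coprime-^ʳ (Coprimality.sym (gcd≡1⇒coprime gcd[q,n]≡1)) k) σ[n²]≡bq^k ab≡n²)
  where instance _ = m^n≢0 q k {{prime⇒nonZero q-prime}}
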